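{- (Soundness of CPPL resolution.) Let $S$ and $S'$ be sets of CPPL sentences. If $S \vdash^r S'$, then $S \models S'$.
   Context: Let $\mathcal{P}$ be a finite or countably infinite set of propositional variables. PPL formulas form the smallest set containing $\mathcal{P}$ such that whenever $n\in\mathbb{N}$ and $\alpha,\beta$ are formulas, the strings $n(\alpha)$, $\neg\alpha$, $(\alpha+\beta)$ are formulas. A literal $\lambda$ is $p$ or $\neg p$ with $p\in\mathcal{P}$; a pseudo-literal is $n\lambda$; a formula is in normal form if it is a sum of pseudo-literals. An interpretation is a subset $I\subseteq\mathcal{P}$, extended to $I:\text{formulas}\to\mathbb{Z}^2$ by $I(p)=(1,0)$ if $p\in I$ and $(0,1)$ otherwise, $I(n\beta)=(nz,nz')$ where $I(\beta)=(z,z')$, $I(\neg\beta)=(z',z)$ where $I(\beta)=(z,z')$, and $I(\beta_1+\beta_2)=I(\beta_1)+I(\beta_2)$ componentwise. A CPPL sentence is $\varphi^{(\bowtie,n)}$ with $\varphi$ a formula, $\bowtie\in\{>,\geq,=,<,\leq\}$, $n\in\mathbb{N}$ (and also $\sim\Phi$ for a sentence $\Phi$). $I\models\varphi^{(\bowtie,n)}$ iff $I(\varphi)=(m,l)$ with $m\bowtie n$; $I\models S$ iff $I\models\Phi$ for all $\Phi\in S$; $S\models S'$ iff every $I$ with $I\models S$ satisfies $I\models S'$. A sentence is standard if it has the form $(\sum_{i=1}^k n_i\lambda_i)^{(\geq,n)}$. For a normal-form formula $\beta=\sum_{i=1}^k m_i\lambda_i$, $|\beta|=\sum_i m_i$ (coefficient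 sum) and $\neg\beta=\sum_i m_i\neg\lambda_i$. The CPPL resolution proof system has two rules: Rule I: if $S\subseteq S'$ then $S'\vdash^r S$; Rule II: if $S\vdash^r \{(\varphi_1+\beta)^{(\geq,n_1)},(\varphi_2+\neg\beta)^{(\geq,n_2)}\}$ then $S\vdash^r\{(\varphi_1+\varphi_2)^{(\geq,n_1+n_2-|\beta|)}\}$ (formulas in normal form). $S\vdash^r S'$ means this statement is obtained by finitely many applications of these rules. -}

module Defs where

open import Data.Nat using (ℕ; _+_; _*_; _∸_; _>_; _≥_; _<_; _≤_)
open import Data.Bool using (Bool; true; false)
open import Data.Product using (_×_; _,_)
open import Data.Sum using (_⊎_)
open import Data.List.NonEmpty using (List⁺; foldr₁; map)
open import Relation.Binary.PropositionalEquality using (_≡_)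
open import Relation.Nullary using (¬_)
open import Relation.Unary using (Pred; _⊆_)
open import Level using (0ℓ)

module CPPL (V : Set) where

  data Formula : Set where
    var   : V → Formula
    scale : ℕ → Formula → Formula
    neg   : Formula → Formula
    plus  : Formula → Formula → Formula

  -- interpretations: subsets I ⊆ V, as characteristic functions
  Interpretation : Set
  Interpretation = V → Bool

  -- I(φ) ∈ ℕ² (all values are non-negative, so ℕ² ⊆ ℤ² suffices)
  ⟦_⟧ : Formula → Interpretation → ℕ × ℕ
  ⟦ var p ⟧ I with I p
  ... | true  = (1 , 0)
  ... | false = (0 , 1)
  ⟦ scale n β ⟧ I with ⟦ β ⟧ I
  ... | (z , z′) = (n * z , n * z′)
  ⟦ neg β ⟧ I with ⟦ β ⟧ I
  ... | (z , z′) = (z′ , z)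
  ⟦ plus β₁ β₂ ⟧ I with ⟦ β₁ ⟧ I | ⟦ β₂ ⟧ I
  ... | (a , b) | (c , d) = (a + c , b + d)

  data Cmp : Set where
    gt ge eq lt le : Cmp

  cmp : Cmp → ℕ → ℕ → Set
  cmp gt m n = m > n
  cmp ge m n = m ≥ n
  cmp eq m n = m ≡ n
  cmp lt m n = m < n
  cmp le m n = m ≤ n

  data Sentence : Set where
    sent : Formula → Cmp → ℕ → Sentence
    ∼_   : Sentence → Sentence

  _⊨_ : Interpretation → Sentence → Set
  I ⊨ sent φ ⋈ n with ⟦ φ ⟧ I
  ... | (m , l) = cmp ⋈ m n
  I ⊨ (∼ Φ) = ¬ (I ⊨ Φ)

  SentenceSet : Set₁
  SentenceSet = Pred Sentence 0ℓ

  _⊨ˢ_ : Interpretation → SentenceSet → Set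
  I ⊨ˢ S = ∀ Φ → S Φ → I ⊨ Φ

  _⊫_ : SentenceSet → SentenceSet → Set
  S ⊫ S′ = ∀ (I : Interpretation) → I ⊨ˢ S → I ⊨ˢ S′

  data Literal : Set where
    pos : V → Literal
    ngt : V → Literal

  litF : Literal → Formula
  litF (pos p) = var p
  litF (ngt p) = neg (var p)

  -- negation of a literal (¬¬p identified with p)
  negLit : Literal → Literal
  negLit (pos p) = ngt p
  negLit (ngt p) = pos p

  -- normal-form formulas: non-empty sums Σ_{i=1}^k m_i λ_i
  NF : Set
  NF = List⁺ (ℕ × Literal)

  pseudo : ℕ × Literal → Formula
  pseudo (m , λ′) = scale m (litF λ′)

  ⌜_⌝ : NF → Formula
  ⌜ β ⌝ = foldr₁ plus (map pseudo β)

  ∣_∣ : NF → ℕ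
  ∣ β ∣ = foldr₁ _+_ (map (λ { (m , _) → m }) β)

  negNF : NF → NF
  negNF = map (λ { (m , λ′) → (m , negLit λ′) })

  ｛_｝ : Sentence → SentenceSet
  ｛ Φ ｝ Ψ = Ψ ≡ Φ

  ｛_；_｝ : Sentence → Sentence → SentenceSet
  ｛ Φ₁ ； Φ₂ ｝ Ψ = Ψ ≡ Φ₁ ⊎ Ψ ≡ Φ₂

  data _⊢ʳ_ : SentenceSet → SentenceSet → Set₁ where
    ruleI  : ∀ {S S′} → S ⊆ S′ → S′ ⊢ʳ S
    ruleII : ∀ {S} (φ₁ φ₂ β : NF) (n₁ n₂ : ℕ) →
             S ⊢ʳ ｛ sent (plus ⌜ φ₁ ⌝ ⌜ β ⌝) ge n₁
                  ； sent (plus ⌜ φ₂ ⌝ ⌜ negNF β ⌝) ge n₂ ｝ →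
             S ⊢ʳ ｛ sent (plus ⌜ φ₁ ⌝ ⌜ φ₂ ⌝) ge (n₁ + n₂ ∸ ∣ β ∣) ｝

{-# OPTIONS --safe #-}
-- Rule I is immediate; Rule II rests on the first components
-- of I(β) and I(¬β) adding up to |β|, since each pseudo-literal m λ contributes m to exactly
-- one of them.  Adding the two premises then gives I(φ₁)₁ + I(φ₂)₁ + |β| ≥ n₁ + n₂.
module Submission where

open import Defs
open import Data.Nat using (ℕ; _+_; _*_; _∸_; _≤_)
open import Data.Nat.Properties
  using (*-distribˡ-+; *-identityʳ; +-comm; +-mono-≤; m≤n+o⇒m∸n≤o; +-commutativeSemigroup)
open import Algebra.Properties.CommutativeSemigroup +-commutativeSemigroup using (interchange)
open import Data.Bool using (true; false)
open import Data.Product using (_,_; proj₁)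
open import Data.Sum using (inj₁; inj₂)
open import Data.List using ([]; _∷_)
open import Data.List.NonEmpty using (_∷_)
open import Function.Definitions using (Injective)
open import Relation.Binary.PropositionalEquality using (_≡_; refl; cong; cong₂; subst; module ≡-Reasoning)

resolvent-bound : ∀ {x₁ x₂ b₁ b₂ n₁ n₂} →
                  n₁ ≤ x₁ + b₁ → n₂ ≤ x₂ + b₂ → n₁ + n₂ ∸ (b₁ + b₂) ≤ x₁ + x₂
resolvent-bound {x₁} {x₂} {b₁} {b₂} {n₁} {n₂} h₁ h₂ =
  m≤n+o⇒m∸n≤o (n₁ + n₂) (b₁ + b₂) (subst (n₁ + n₂ ≤_) regroup (+-mono-≤ h₁ h₂))
  where
  open ≡-Reasoning
  regroup : (x₁ + b₁) + (x₂ + b₂) ≡ (b₁ + b₂) + (x₁ + x₂)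
  regroup = begin
    (x₁ + b₁) + (x₂ + b₂)  ≡⟨ interchange x₁ b₁ x₂ b₂ ⟩
    (x₁ + x₂) + (b₁ + b₂)  ≡⟨ +-comm (x₁ + x₂) (b₁ + b₂) ⟩
    (b₁ + b₂) + (x₁ + x₂)  ∎

module Soundness (V : Set) where
  open CPPL V

  ⟦_⟧₁ : Formula → Interpretation → ℕ
  ⟦ φ ⟧₁ I = proj₁ (⟦ φ ⟧ I)

  literal+negLit≡1 : ∀ l I → ⟦ litF l ⟧₁ I + ⟦ litF (negLit l) ⟧₁ I ≡ 1
  literal+negLit≡1 (pos p) I with I p
  ... | true  = refl
  ... | false = refl
  literal+negLit≡1 (ngt p) I with I p
  ... | true  = refl
  ... | false = refl

  pseudo+negPseudo≡coefficient : ∀ m l I →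
    ⟦ pseudo (m , l) ⟧₁ I + ⟦ pseudo (m , negLit l) ⟧₁ I ≡ m
  pseudo+negPseudo≡coefficient m l I = begin
    m * ⟦ litF l ⟧₁ I + m * ⟦ litF (negLit l) ⟧₁ I  ≡⟨ *-distribˡ-+ m _ _ ⟨
    m * (⟦ litF l ⟧₁ I + ⟦ litF (negLit l) ⟧₁ I)    ≡⟨ cong (m *_) (literal+negLit≡1 l I) ⟩
    m * 1                                          ≡⟨ *-identityʳ m ⟩
    m                                              ∎
    where open ≡-Reasoning

  nf+negNF≡∣∣ : ∀ β I → ⟦ ⌜ β ⌝ ⟧₁ I + ⟦ ⌜ negNF β ⌝ ⟧₁ I ≡ ∣ β ∣
  nf+negNF≡∣∣ (x ∷ xs) I = go x xs
    where
    open ≡-Reasoning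
    -- recursion on the tail, since List⁺ is a record and x ∷ xs is not structurally smaller
    go : ∀ x xs → ⟦ ⌜ x ∷ xs ⌝ ⟧₁ I + ⟦ ⌜ negNF (x ∷ xs) ⌝ ⟧₁ I ≡ ∣ x ∷ xs ∣
    go (m , l) []       = pseudo+negPseudo≡coefficient m l I
    go (m , l) (y ∷ ys) = begin
      (a + r) + (ā + r̄)  ≡⟨ interchange a r ā r̄ ⟩
      (a + ā) + (r + r̄)  ≡⟨ cong₂ _+_ (pseudo+negPseudo≡coefficient m l I) (go y ys) ⟩
      m + ∣ y ∷ ys ∣     ∎
      where
      a ā r r̄ : ℕ
      a = ⟦ pseudo (m , l) ⟧₁ I
      ā = ⟦ pseudo (m , negLit l) ⟧₁ I
      r = ⟦ ⌜ y ∷ ys ⌝ ⟧₁ I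
      r̄ = ⟦ ⌜ negNF (y ∷ ys) ⌝ ⟧₁ I

  sound : ∀ {S S′} → S ⊢ʳ S′ → S ⊫ S′
  sound (ruleI S′⊆S) I I⊨S Φ Φ∈S′ = I⊨S Φ (S′⊆S Φ∈S′)
  sound (ruleII φ₁ φ₂ β n₁ n₂ premises) I I⊨S Φ refl =
    subst (λ k → n₁ + n₂ ∸ k ≤ ⟦ ⌜ φ₁ ⌝ ⟧₁ I + ⟦ ⌜ φ₂ ⌝ ⟧₁ I) (nf+negNF≡∣∣ β I)
          (resolvent-bound {⟦ ⌜ φ₁ ⌝ ⟧₁ I} {⟦ ⌜ φ₂ ⌝ ⟧₁ I} {⟦ ⌜ β ⌝ ⟧₁ I} {⟦ ⌜ negNF β ⌝ ⟧₁ I}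
                           (I⊨premises _ (inj₁ refl)) (I⊨premises _ (inj₂ refl)))
    where
    I⊨premises : I ⊨ˢ ｛ sent (plus ⌜ φ₁ ⌝ ⌜ β ⌝) ge n₁ ； sent (plus ⌜ φ₂ ⌝ ⌜ negNF β ⌝) ge n₂ ｝
    I⊨premises = sound premises I I⊨S

theorem3p1 : (V : Set) (code : V → ℕ) → Injective _≡_ _≡_ code →
    (S S′ : CPPL.SentenceSet V) →
    CPPL._⊢ʳ_ V S S′ → CPPL._⊫_ V S S′
theorem3p1 V _ _ S S′ = Soundness.sound V
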